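{- For each integer $m\ge 4$, let $F(m)$ denote the minimum number of edges in a connected $m$-vertex graph with a $(4,1)$-cover. Let $n,q,r$ be integers with $n-4=3q+r$, $q\ge 0$ and $1\le r\le 3$. Then $F(n)-F(n-1)\le 3$, and $F(n)-F(n-1)=3$ if and only if $r=1$.
   Context: A graph has a $(4,1)$-cover if every edge lies in at least one copy of $K_4$ (a subgraph isomorphic to the complete graph on 4 vertices). -}

module Defs where

open import Data.Nat using (ℕ; zero; suc; _+_; _<ᵇ_)
open import Data.Bool using (Bool; true; false; _∧_; if_then_else_)
open import Data.Fin using (Fin; toℕ)
open import Data.List using (List; map; allFin)
open import Data.Nat.ListAction using (sum)
open import Data.Product using (Σ; _×_; ∃; ∃-syntax)
open import Relation.Binary.PropositionalEquality using (_≡_)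

record Graph (m : ℕ) : Set where
  field
    adj    : Fin m → Fin m → Bool
    sym    : ∀ i j → adj i j ≡ adj j i
    irrefl : ∀ i → adj i i ≡ false
open Graph public

edgeCount : ∀ {m} → Graph m → ℕ
edgeCount {m} G =
  sum (map (λ i → sum (map (λ j →
        if (toℕ i <ᵇ toℕ j) ∧ adj G i j then 1 else 0) (allFin m))) (allFin m))

data Reach {m : ℕ} (G : Graph m) : Fin m → Fin m → Set where
  here : ∀ {i} → Reach G i i
  step : ∀ {i k j} → adj G i k ≡ true → Reach G k j → Reach G i j

Connected : ∀ {m} → Graph m → Set
Connected {m} G = ∀ (i j : Fin m) → Reach G i j

-- The edge uv lies in a copy of K4: there are vertices w, x such that
-- u, v, w, x are pairwise adjacent (distinctness follows from irreflexivity).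
InK4 : ∀ {m} → Graph m → Fin m → Fin m → Set
InK4 {m} G u v = ∃[ w ] ∃[ x ]
  (adj G u w ≡ true × adj G u x ≡ true × adj G v w ≡ true ×
   adj G v x ≡ true × adj G w x ≡ true)

Has41Cover : ∀ {m} → Graph m → Set
Has41Cover {m} G = ∀ (u v : Fin m) → adj G u v ≡ true → InK4 G u v

IsF : ℕ → ℕ → Set
IsF m k =
  (Σ (Graph m) λ G → Connected G × Has41Cover G × edgeCount G ≡ k)
  × (∀ (G : Graph m) → Connected G → Has41Cover G → k Data.Nat.≤ edgeCount G)

-- F(n) = 2n − 2 when n ≡ 1 (mod 3) and F(n) = 2n − 1 otherwise, which gives
-- F(n) − F(n − 1) = 4 − r.
--
-- Lower bound: grow a vertex set S from a single vertex. While S is not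
-- everything, connectivity gives an edge uv leaving S and the cover gives a K4
-- on uv; adding the 1, 2 or 3 vertices of that K4 missing from S adds at least
-- 3, 5 or 6 edges inside S. Hence e(S) ≥ 2|S| − 2 throughout, and
-- e(S) ≥ 2|S| − 1 from the first step that adds fewer than three vertices
-- onwards; a process that only ever adds three vertices keeps |S| ≡ 1 (mod 3).
--
-- Upper bound: a chain of K4s, consecutive ones sharing a vertex, has
-- 1 + 3q vertices and 6q edges; a further K4 glued along a triangle or along an
-- edge of the last one adds 1 vertex and 3 edges, or 2 vertices and 5 edges.
module Submission where

open import Defs hiding (sym)
open import Data.Bool using (Bool; true; false; if_then_else_; _∧_; _∨_; not)
open import Data.Bool.Properties using (∨-zeroʳ; ¬-not) renaming (_≟_ to _≟ᵇ_)
open import Data.Fin using (Fin; zero; suc; toℕ)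
open import Data.Fin.Patterns using (0F; 1F; 2F; 3F)
open import Data.Fin.Properties using (_≟_; <-cmp; any?)
open import Data.List using (List; []; _∷_; map; allFin; tabulate; length)
open import Data.List.Properties using (map-tabulate)
open import Data.List.Relation.Unary.All as All using (All; []; _∷_)
open import Data.List.Relation.Unary.AllPairs using ([]; _∷_)
open import Data.List.Relation.Unary.Unique.Propositional using (Unique)
open import Data.Nat using (ℕ; zero; suc; _+_; _*_; _∸_; _≤_; z≤n; s≤s; _<ᵇ_; _%_)
import Data.Nat.ListAction as List
open import Data.Nat.DivMod using ([m+n]%n≡m%n; [m+kn]%n≡m%n)
open import Data.Nat.Properties
  using ( +-0-commutativeMonoid; +-commutativeSemigroup; _<?_; n≮n; +-identityʳ; +-assoc; +-comm
        ; +-suc; *-assoc; *-distribˡ-+; ≤-refl; ≤-reflexive; ≤-trans; ≤-antisym; +-mono-≤; +-monoˡ-≤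
        ; +-monoʳ-≤; m≤m+n; m≤n+m; n≤1+n; 1+n≰n; +-cancelʳ-≡; +-cancelʳ-≤; *-cancelˡ-≤; module ≤-Reasoning)
open import Data.Nat.Tactic.RingSolver using (solve-∀)
open import Algebra.Properties.CommutativeMonoid.Sum +-0-commutativeMonoid
  using (sum-syntax; ∑-distrib-+; ∑-comm; sum-cong-≗; sum-replicate-zero)
open import Algebra.Properties.CommutativeSemigroup +-commutativeSemigroup using (xy∙z≈x∙zy)
open import Data.Product using (_×_; _,_; ∃-syntax)
open import Function using (_∘_)
open import Function.Bundles using (_⇔_; mk⇔)
open import Relation.Binary using (tri<; tri≈; tri>)
open import Relation.Binary.PropositionalEquality
open import Relation.Nullary using (does; yes; no; contradiction)
open import Relation.Nullary.Decidable using (dec-true; dec-false)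

⟦_⟧ : Bool → ℕ
⟦ b ⟧ = if b then 1 else 0

∑-select : ∀ {n} (v : Fin n) (f : Fin n → ℕ) → ∑[ i < n ] (if does (i ≟ v) then f i else 0) ≡ f v
∑-select {suc n} zero    f = trans (cong (f zero +_) (sum-replicate-zero n)) (+-identityʳ (f zero))
∑-select {suc n} (suc v) f = ∑-select v (f ∘ suc)

∑∑-distrib-+ : ∀ {m n} (f g : Fin m → Fin n → ℕ) →
               ∑[ i < m ] ∑[ j < n ] (f i j + g i j)
                 ≡ ∑[ i < m ] ∑[ j < n ] f i j + ∑[ i < m ] ∑[ j < n ] g i j
∑∑-distrib-+ {n = n} f g =
  trans (sum-cong-≗ λ i → ∑-distrib-+ (f i) (g i))
        (∑-distrib-+ (λ i → ∑[ j < n ] f i j) (λ i → ∑[ j < n ] g i j))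

sum-map-allFin : ∀ {n} (f : Fin n → ℕ) → List.sum (map f (allFin n)) ≡ ∑[ i < n ] f i
sum-map-allFin f = trans (cong List.sum (map-tabulate (λ i → i) f)) (sum-tabulate f)
  where
  sum-tabulate : ∀ {n} (f : Fin n → ℕ) → List.sum (tabulate f) ≡ ∑[ i < n ] f i
  sum-tabulate {zero}  f = refl
  sum-tabulate {suc n} f = cong (f zero +_) (sum-tabulate (f ∘ suc))

count : ∀ {n} → (Fin n → Bool) → ℕ
count {n} P = ∑[ i < n ] ⟦ P i ⟧

count-≤ : ∀ {n} (P : Fin n → Bool) → count P ≤ n
count-≤ {zero}  P = z≤n
count-≤ {suc n} P = +-mono-≤ (⟦⟧≤1 (P zero)) (count-≤ (P ∘ suc))
  where
  ⟦⟧≤1 : ∀ b → ⟦ b ⟧ ≤ 1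
  ⟦⟧≤1 true  = s≤s z≤n
  ⟦⟧≤1 false = z≤n

count-full : ∀ {n} {P : Fin n → Bool} → (∀ i → P i ≡ true) → count P ≡ n
count-full {zero}  full = refl
count-full {suc n} full = cong₂ (λ b c → ⟦ b ⟧ + c) (full zero) (count-full (full ∘ suc))

_∖_ : ∀ {n} → (Fin n → Bool) → Fin n → Fin n → Bool
(P ∖ v) i = not (does (i ≟ v)) ∧ P i

count-∖ : ∀ {n} (P : Fin n → Bool) v → count P ≡ ⟦ P v ⟧ + count (P ∖ v)
count-∖ {n} P v = begin
  count P                             ≡⟨ sum-cong-≗ split ⟩
  ∑[ i < n ] (atV i + ⟦ (P ∖ v) i ⟧)  ≡⟨ ∑-distrib-+ atV (⟦_⟧ ∘ (P ∖ v)) ⟩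
  ∑[ i < n ] atV i + count (P ∖ v)    ≡⟨ cong (_+ count (P ∖ v)) (∑-select v (⟦_⟧ ∘ P)) ⟩
  ⟦ P v ⟧ + count (P ∖ v)             ∎
  where
  open ≡-Reasoning
  atV : Fin n → ℕ
  atV i = if does (i ≟ v) then ⟦ P i ⟧ else 0
  split : ∀ i → ⟦ P i ⟧ ≡ atV i + ⟦ (P ∖ v) i ⟧
  split i with does (i ≟ v)
  ... | true  = sym (+-identityʳ _)
  ... | false = refl

length≤count : ∀ {n} {P : Fin n → Bool} {us : List (Fin n)} →
               Unique us → All (λ u → P u ≡ true) us → length us ≤ count P
length≤count []                []          = z≤n
length≤count {P = P} {u ∷ us} (u∉us ∷ !us) (Pu ∷ Pus) = begin
  suc (length us)         ≤⟨ s≤s (length≤count !us (All.zipWith removed (u∉us , Pus))) ⟩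
  suc (count (P ∖ u))     ≡⟨ cong (λ b → ⟦ b ⟧ + count (P ∖ u)) Pu ⟨
  ⟦ P u ⟧ + count (P ∖ u) ≡⟨ count-∖ P u ⟨
  count P                 ∎
  where
  open ≤-Reasoning
  removed : ∀ {x} → u ≢ x × P x ≡ true → (P ∖ u) x ≡ true
  removed {x} (u≢x , Px) = cong₂ (λ b c → not b ∧ c) (dec-false (x ≟ u) (u≢x ∘ sym)) Px

module _ {m : ℕ} (G : Graph m) where

  adj-sym : ∀ {i j} → adj G i j ≡ true → adj G j i ≡ true
  adj-sym {i} {j} e = trans (Graph.sym G j i) e

  adj⇒≢ : ∀ {i j} → adj G i j ≡ true → i ≢ j
  adj⇒≢ {i} e refl with () ← trans (sym e) (irrefl G i)

  forwardEdge : Fin m → Fin m → ℕ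
  forwardEdge i j = ⟦ (toℕ i <ᵇ toℕ j) ∧ adj G i j ⟧

  edgeSum : ℕ
  edgeSum = ∑[ i < m ] ∑[ j < m ] forwardEdge i j

  edgeCount≡edgeSum : edgeCount G ≡ edgeSum
  edgeCount≡edgeSum = trans (sum-map-allFin row) (sum-cong-≗ λ i → sum-map-allFin (forwardEdge i))
    where
    row : Fin m → ℕ
    row i = List.sum (map (forwardEdge i) (allFin m))

  handshake : ∑[ i < m ] ∑[ j < m ] ⟦ adj G i j ⟧ ≡ 2 * edgeCount G
  handshake = begin
    ∑[ i < m ] ∑[ j < m ] ⟦ adj G i j ⟧
      ≡⟨ sum-cong-≗ (λ i → sum-cong-≗ (split i)) ⟩
    ∑[ i < m ] ∑[ j < m ] (forwardEdge i j + forwardEdge j i)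
      ≡⟨ ∑∑-distrib-+ forwardEdge (λ i j → forwardEdge j i) ⟩
    edgeSum + ∑[ i < m ] ∑[ j < m ] forwardEdge j i
      ≡⟨ cong (edgeSum +_) (∑-comm (λ i j → forwardEdge j i)) ⟩
    edgeSum + edgeSum
      ≡⟨ cong (edgeSum +_) (+-identityʳ edgeSum) ⟨
    2 * edgeSum
      ≡⟨ cong (2 *_) edgeCount≡edgeSum ⟨
    2 * edgeCount G
      ∎
    where
    open ≡-Reasoning
    split : ∀ i j → ⟦ adj G i j ⟧ ≡ forwardEdge i j + forwardEdge j i
    split i j with <-cmp i j
    ... | tri< i<j _ j≮i rewrite dec-true (toℕ i <? toℕ j) i<j | dec-false (toℕ j <? toℕ i) j≮i =
      sym (+-identityʳ _)
    ... | tri≈ _ refl _ rewrite dec-false (toℕ i <? toℕ i) (n≮n (toℕ i)) | irrefl G i = refl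
    ... | tri> i≮j _ j<i rewrite dec-false (toℕ i <? toℕ j) i≮j | dec-true (toℕ j <? toℕ i) j<i =
      cong ⟦_⟧ (Graph.sym G i j)

  crossing-edge : ∀ (S : Fin m → Bool) {s t} → S s ≡ true → S t ≡ false → Reach G s t →
                  ∃[ u ] ∃[ v ] S u ≡ true × S v ≡ false × adj G u v ≡ true
  crossing-edge S s∈S t∉S here with () ← trans (sym s∈S) t∉S
  crossing-edge S {s} s∈S t∉S (step {k = k} s~k k⇝t) with S k in Sk
  ... | true  = crossing-edge S Sk t∉S k⇝t
  ... | false = s , k , s∈S , Sk , s~k

-- d stands for twice the number of edges among n vertices: the invariant is
-- e ≥ 2n − 2, improved to e ≥ 2n − 1 unless n ≡ 1 (mod 3).
data DegreeSumBound (n d : ℕ) : Set where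
  tight : n % 3 ≡ 1 → 4 * n ≤ d + 4 → DegreeSumBound n d
  loose : 4 * n ≤ d + 2 → DegreeSumBound n d

-- Absorbing a K4 that meets the current set in 4 − k vertices adds k vertices
-- and at least Δ to the degree sum.
data Gain : ℕ → ℕ → Set where
  gain₁ : Gain 1 6
  gain₂ : Gain 2 10
  gain₃ : Gain 3 12

gain-positive : ∀ {k Δ} → Gain k Δ → 1 ≤ k
gain-positive gain₁ = s≤s z≤n
gain-positive gain₂ = s≤s z≤n
gain-positive gain₃ = s≤s z≤n

slack-step : ∀ n d k {s Δ s′ d′} → 4 * n ≤ d + s → 4 * k + s ≤ Δ + s′ → d + Δ ≤ d′ →
             4 * (n + k) ≤ d′ + s′
slack-step n d k {s} {Δ} {s′} {d′} n≤d k≤Δ d+Δ≤d′ = begin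
  4 * (n + k)     ≡⟨ *-distribˡ-+ 4 n k ⟩
  4 * n + 4 * k   ≤⟨ +-monoˡ-≤ (4 * k) n≤d ⟩
  d + s + 4 * k   ≡⟨ xy∙z≈x∙zy d s (4 * k) ⟩
  d + (4 * k + s) ≤⟨ +-monoʳ-≤ d k≤Δ ⟩
  d + (Δ + s′)    ≡⟨ +-assoc d Δ s′ ⟨
  d + Δ + s′      ≤⟨ +-monoˡ-≤ s′ d+Δ≤d′ ⟩
  d′ + s′         ∎
  where open ≤-Reasoning

absorb-bound : ∀ {n d k Δ d′} → DegreeSumBound n d → Gain k Δ → d + Δ ≤ d′ → DegreeSumBound (n + k) d′
absorb-bound {n} {d} (tight _ b)   gain₁ le = loose (slack-step n d 1 b ≤-refl le)
absorb-bound {n} {d} (tight _ b)   gain₂ le = loose (slack-step n d 2 b ≤-refl le)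
absorb-bound {n} {d} (tight ≡1 b)  gain₃ le =
  tight (trans ([m+n]%n≡m%n n 3) ≡1) (slack-step n d 3 b ≤-refl le)
absorb-bound {n} {d} (loose b)     gain₁ le = loose (slack-step n d 1 b (m≤m+n 6 2) le)
absorb-bound {n} {d} (loose b)     gain₂ le = loose (slack-step n d 2 b (m≤m+n 10 2) le)
absorb-bound {n} {d} (loose b)     gain₃ le = loose (slack-step n d 3 b ≤-refl le)

module VertexSets {m : ℕ} (G : Graph m) where

  insert : Fin m → (Fin m → Bool) → Fin m → Bool
  insert v S i = does (i ≟ v) ∨ S i

  insert-self : ∀ S v → insert v S v ≡ true
  insert-self S v = cong (_∨ S v) (dec-true (v ≟ v) refl)

  insert-⊇ : ∀ S v {i} → S i ≡ true → insert v S i ≡ true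
  insert-⊇ S v {i} i∈S = trans (cong (does (i ≟ v) ∨_) i∈S) (∨-zeroʳ _)

  insert-∉ : ∀ S {v i} → i ≢ v → S i ≡ false → insert v S i ≡ false
  insert-∉ S {i = i} i≢v i∉S = cong₂ _∨_ (dec-false (i ≟ _) i≢v) i∉S

  insert-All : ∀ {S v us} → All (λ u → S u ≡ true) us → All (λ u → insert v S u ≡ true) (v ∷ us)
  insert-All {S} {v} us∈S = insert-self S v ∷ All.map (insert-⊇ S v) us∈S

  count-insert : ∀ {S v} → S v ≡ false → count (insert v S) ≡ count S + 1
  count-insert {S} {v} v∉S = begin
    count (insert v S)
      ≡⟨ count-∖ (insert v S) v ⟩
    ⟦ insert v S v ⟧ + count (insert v S ∖ v)
      ≡⟨ cong₂ (λ b c → ⟦ b ⟧ + c) (insert-self S v) (sum-cong-≗ removed) ⟩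
    1 + count S
      ≡⟨ +-comm 1 (count S) ⟩
    count S + 1
      ∎
    where
    open ≡-Reasoning
    removed : ∀ i → ⟦ (insert v S ∖ v) i ⟧ ≡ ⟦ S i ⟧
    removed i with i ≟ v
    ... | yes refl = cong ⟦_⟧ (sym v∉S)
    ... | no _     = refl

  degreeIn : (Fin m → Bool) → Fin m → ℕ
  degreeIn S v = count (λ j → S j ∧ adj G v j)

  degreeSum : (Fin m → Bool) → ℕ
  degreeSum S = ∑[ i < m ] ∑[ j < m ] ⟦ S i ∧ S j ∧ adj G i j ⟧

  degreeSum-full : ∀ {S} → (∀ i → S i ≡ true) → degreeSum S ≡ 2 * edgeCount G
  degreeSum-full full =
    trans (sum-cong-≗ λ i → sum-cong-≗ λ j → cong₂ (λ a b → ⟦ a ∧ b ∧ adj G i j ⟧) (full i) (full j))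
          (handshake G)

  degreeSum-insert : ∀ {S v} → S v ≡ false →
                     degreeSum (insert v S) ≡ degreeSum S + (degreeIn S v + degreeIn S v)
  degreeSum-insert {S} {v} v∉S = begin
    degreeSum (insert v S)
      ≡⟨ sum-cong-≗ (λ i → sum-cong-≗ (split i)) ⟩
    ∑[ i < m ] ∑[ j < m ] (inside i j + (fromV i j + toV i j))
      ≡⟨ ∑∑-distrib-+ inside (λ i j → fromV i j + toV i j) ⟩
    degreeSum S + ∑[ i < m ] ∑[ j < m ] (fromV i j + toV i j)
      ≡⟨ cong (degreeSum S +_) (∑∑-distrib-+ fromV toV) ⟩
    degreeSum S + (∑[ i < m ] ∑[ j < m ] fromV i j + ∑[ i < m ] ∑[ j < m ] toV i j)
      ≡⟨ cong (degreeSum S +_) (cong₂ _+_ ∑∑fromV ∑∑toV) ⟩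
    degreeSum S + (degreeIn S v + degreeIn S v)
      ∎
    where
    open ≡-Reasoning
    inside fromV toV : Fin m → Fin m → ℕ
    inside i j = ⟦ S i ∧ S j ∧ adj G i j ⟧
    fromV  i j = if does (i ≟ v) then ⟦ S j ∧ adj G i j ⟧ else 0
    toV    i j = if does (j ≟ v) then ⟦ S i ∧ adj G i j ⟧ else 0
    split : ∀ i j → ⟦ insert v S i ∧ insert v S j ∧ adj G i j ⟧ ≡ inside i j + (fromV i j + toV i j)
    split i j with i ≟ v | j ≟ v
    ... | yes refl | yes refl rewrite v∉S | irrefl G v = refl
    ... | yes refl | no _     rewrite v∉S = sym (+-identityʳ _)
    ... | no _     | yes refl rewrite v∉S with S i
    ...   | true  = refl
    ...   | false = refl
    split i j | no _ | no _ = sym (+-identityʳ _)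
    ∑∑fromV : ∑[ i < m ] ∑[ j < m ] fromV i j ≡ degreeIn S v
    ∑∑fromV = trans (∑-comm fromV) (sum-cong-≗ λ j → ∑-select v (λ i → ⟦ S j ∧ adj G i j ⟧))
    ∑∑toV : ∑[ i < m ] ∑[ j < m ] toV i j ≡ degreeIn S v
    ∑∑toV = sum-cong-≗ λ i →
      trans (∑-select v (λ j → ⟦ S i ∧ adj G i j ⟧)) (cong (λ b → ⟦ S i ∧ b ⟧) (Graph.sym G i v))

  record Extension (S : Fin m → Bool) (k Δ : ℕ) : Set where
    field
      grown           : Fin m → Bool
      ⊆-grown         : ∀ {i} → S i ≡ true → grown i ≡ true
      count-grown     : count grown ≡ count S + k
      degreeSum-grown : degreeSum S + Δ ≤ degreeSum grown
  open Extension public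

  infixl 5 _⨾_
  _⨾_ : ∀ {S k Δ k′ Δ′} (E : Extension S k Δ) → Extension (grown E) k′ Δ′ → Extension S (k + k′) (Δ + Δ′)
  _⨾_ {S} {k} {Δ} {k′} {Δ′} E E′ = record
    { grown           = grown E′
    ; ⊆-grown         = ⊆-grown E′ ∘ ⊆-grown E
    ; count-grown     = begin-equality
        count (grown E′)          ≡⟨ count-grown E′ ⟩
        count (grown E) + k′      ≡⟨ cong (_+ k′) (count-grown E) ⟩
        count S + k + k′          ≡⟨ +-assoc (count S) k k′ ⟩
        count S + (k + k′)        ∎
    ; degreeSum-grown = begin
        degreeSum S + (Δ + Δ′)    ≡⟨ +-assoc (degreeSum S) Δ Δ′ ⟨
        degreeSum S + Δ + Δ′      ≤⟨ +-monoˡ-≤ Δ′ (degreeSum-grown E) ⟩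
        degreeSum (grown E) + Δ′  ≤⟨ degreeSum-grown E′ ⟩
        degreeSum (grown E′)      ∎
    }
    where open ≤-Reasoning

  insertion : ∀ S v (us : List (Fin m)) → S v ≡ false → Unique us →
              All (λ u → S u ≡ true) us → All (λ u → adj G v u ≡ true) us →
              Extension S 1 (length us + length us)
  insertion S v us v∉S !us us∈S v~us = record
    { grown           = insert v S
    ; ⊆-grown         = insert-⊇ S v
    ; count-grown     = count-insert v∉S
    ; degreeSum-grown = begin
        degreeSum S + (length us + length us)       ≤⟨ +-monoʳ-≤ (degreeSum S) (+-mono-≤ us≤deg us≤deg) ⟩
        degreeSum S + (degreeIn S v + degreeIn S v) ≡⟨ degreeSum-insert v∉S ⟨
        degreeSum (insert v S)                      ∎
    }
    where
    open ≤-Reasoning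
    us≤deg : length us ≤ degreeIn S v
    us≤deg = length≤count !us (All.zipWith (λ (u∈S , v~u) → cong₂ _∧_ u∈S v~u) (us∈S , v~us))

  edge⇒unique : ∀ {a b} → adj G a b ≡ true → Unique (a ∷ b ∷ [])
  edge⇒unique a~b = (adj⇒≢ G a~b ∷ []) ∷ [] ∷ []

  triangle⇒unique : ∀ {a b c} → adj G a b ≡ true → adj G a c ≡ true → adj G b c ≡ true →
                    Unique (a ∷ b ∷ c ∷ [])
  triangle⇒unique a~b a~c b~c = (adj⇒≢ G a~b ∷ adj⇒≢ G a~c ∷ []) ∷ (adj⇒≢ G b~c ∷ []) ∷ [] ∷ []

  module _ {S : Fin m → Bool} {u v w x : Fin m} (u∈S : S u ≡ true) (v∉S : S v ≡ false)
           (u~v : adj G u v ≡ true) (u~w : adj G u w ≡ true) (u~x : adj G u x ≡ true)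
           (v~w : adj G v w ≡ true) (v~x : adj G v x ≡ true) (w~x : adj G w x ≡ true) where

    absorb-one : S w ≡ true → S x ≡ true → Extension S 1 6
    absorb-one w∈S x∈S =
      insertion S v (u ∷ w ∷ x ∷ []) v∉S (triangle⇒unique u~w u~x w~x)
        (u∈S ∷ w∈S ∷ x∈S ∷ []) (adj-sym G u~v ∷ v~w ∷ v~x ∷ [])

    absorb-two : S w ≡ true → S x ≡ false → Extension S 2 10
    absorb-two w∈S x∉S =
      insertion S v (u ∷ w ∷ []) v∉S (edge⇒unique u~w) (u∈S ∷ w∈S ∷ []) (adj-sym G u~v ∷ v~w ∷ [])
      ⨾ insertion (insert v S) x (v ∷ u ∷ w ∷ []) (insert-∉ S (adj⇒≢ G (adj-sym G v~x)) x∉S)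
          (triangle⇒unique (adj-sym G u~v) v~w u~w) (insert-All (u∈S ∷ w∈S ∷ []))
          (adj-sym G v~x ∷ adj-sym G u~x ∷ adj-sym G w~x ∷ [])

    absorb-three : S w ≡ false → S x ≡ false → Extension S 3 12
    absorb-three w∉S x∉S =
      insertion S v (u ∷ []) v∉S ([] ∷ []) (u∈S ∷ []) (adj-sym G u~v ∷ [])
      ⨾ insertion (insert v S) w (v ∷ u ∷ []) (insert-∉ S (adj⇒≢ G (adj-sym G v~w)) w∉S)
          (edge⇒unique (adj-sym G u~v)) (insert-All (u∈S ∷ [])) (adj-sym G v~w ∷ adj-sym G u~w ∷ [])
      ⨾ insertion (insert w (insert v S)) x (w ∷ v ∷ u ∷ [])
          (insert-∉ (insert v S) (adj⇒≢ G (adj-sym G w~x)) (insert-∉ S (adj⇒≢ G (adj-sym G v~x)) x∉S))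
          (triangle⇒unique (adj-sym G v~w) (adj-sym G u~w) (adj-sym G u~v))
          (insert-All (insert-All (u∈S ∷ [])))
          (adj-sym G w~x ∷ adj-sym G v~x ∷ adj-sym G u~x ∷ [])

  absorbK4 : ∀ {S u v} → S u ≡ true → S v ≡ false → adj G u v ≡ true → InK4 G u v →
             ∃[ k ] ∃[ Δ ] Gain k Δ × Extension S k Δ
  absorbK4 {S} u∈S v∉S u~v (w , x , u~w , u~x , v~w , v~x , w~x) with S w in Sw | S x in Sx
  ... | true  | true  = _ , _ , gain₁ , absorb-one u∈S v∉S u~v u~w u~x v~w v~x w~x Sw Sx
  ... | true  | false = _ , _ , gain₂ , absorb-two u∈S v∉S u~v u~w u~x v~w v~x w~x Sw Sx
  ... | false | true  = _ , _ , gain₂ , absorb-two u∈S v∉S u~v u~x u~w v~x v~w (adj-sym G w~x) Sx Sw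
  ... | false | false = _ , _ , gain₃ , absorb-three u∈S v∉S u~v u~w u~x v~w v~x w~x Sw Sx

module Growth {m : ℕ} (G : Graph m) (conn : Connected G) (cov : Has41Cover G) where
  open VertexSets G

  grow : ∀ {s} (f : ℕ) (S : Fin m → Bool) → S s ≡ true → m ≤ f + count S →
         DegreeSumBound (count S) (degreeSum S) → DegreeSumBound m (2 * edgeCount G)
  grow f S s∈S fuel bound with any? (λ i → S i ≟ᵇ false)
  ... | no none = subst₂ DegreeSumBound (count-full full) (degreeSum-full full) bound
    where
    full : ∀ i → S i ≡ true
    full i = ¬-not (λ Si≡false → none (i , Si≡false))
  grow zero S s∈S fuel bound | yes (t , t∉S) = contradiction overfull 1+n≰n
    where
    overfull : suc (count S) ≤ count S
    overfull = begin
      suc (count S)       ≡⟨ +-comm 1 (count S) ⟩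
      count S + 1         ≡⟨ count-insert t∉S ⟨
      count (insert t S)  ≤⟨ count-≤ (insert t S) ⟩
      m                   ≤⟨ fuel ⟩
      count S             ∎
      where open ≤-Reasoning
  grow (suc f) S s∈S fuel bound | yes (t , t∉S) with crossing-edge G S s∈S t∉S (conn _ t)
  ... | u , v , u∈S , v∉S , u~v with absorbK4 u∈S v∉S u~v (cov u v u~v)
  ... | k , Δ , gain , E = grow f (grown E) (⊆-grown E s∈S) fuel′ bound′
    where
    fuel′ : m ≤ f + count (grown E)
    fuel′ = begin
      m                    ≤⟨ fuel ⟩
      suc f + count S      ≡⟨ +-suc f (count S) ⟨
      f + suc (count S)    ≡⟨ cong (f +_) (+-comm 1 (count S)) ⟩
      f + (count S + 1)    ≤⟨ +-monoʳ-≤ f (+-monoʳ-≤ (count S) (gain-positive gain)) ⟩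
      f + (count S + k)    ≡⟨ cong (f +_) (count-grown E) ⟨
      f + count (grown E)  ∎
      where open ≤-Reasoning
    bound′ : DegreeSumBound (count (grown E)) (degreeSum (grown E))
    bound′ = subst (λ c → DegreeSumBound c (degreeSum (grown E))) (sym (count-grown E))
                   (absorb-bound bound gain (degreeSum-grown E))

  degreeSumBound : Fin m → DegreeSumBound m (2 * edgeCount G)
  degreeSumBound s = grow {s} m S₀ (insert-self _ s) (m≤m+n m (count S₀)) (tight (cong (_% 3) count-S₀) 4≤d+4)
    where
    S₀ = insert s (λ _ → false)
    count-S₀ : count S₀ ≡ 1
    count-S₀ = trans (count-insert refl) (cong (_+ 1) (sum-replicate-zero m))
    4≤d+4 : 4 * count S₀ ≤ degreeSum S₀ + 4
    4≤d+4 = subst (λ c → 4 * c ≤ degreeSum S₀ + 4) (sym count-S₀) (m≤n+m 4 _)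

halve : ∀ n e s → 4 * n ≤ 2 * e + 2 * s → 2 * n ≤ e + s
halve n e s le = *-cancelˡ-≤ 2 (subst₂ _≤_ (*-assoc 2 2 n) (sym (*-distribˡ-+ 2 e s)) le)

module _ {m : ℕ} (G : Graph (suc m)) (conn : Connected G) (cov : Has41Cover G) where
  open Growth G conn cov

  edgeCount-lowerBound : 2 * suc m ≤ edgeCount G + 2
  edgeCount-lowerBound with degreeSumBound zero
  ... | tight _ b = halve (suc m) (edgeCount G) 2 b
  ... | loose b   = halve (suc m) (edgeCount G) 2 (≤-trans b (+-monoʳ-≤ (2 * edgeCount G) (m≤n+m 2 2)))

  edgeCount-lowerBound-≢1 : suc m % 3 ≢ 1 → 2 * suc m ≤ edgeCount G + 1
  edgeCount-lowerBound-≢1 ≢1 with degreeSumBound zero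
  ... | tight ≡1 _ = contradiction ≡1 ≢1
  ... | loose b    = halve (suc m) (edgeCount G) 1 b

addVertex : ∀ {m} → Graph m → (Fin m → Bool) → Graph (suc m)
addVertex {m} G N = record { adj = adj′ ; sym = sym′ ; irrefl = irrefl′ }
  where
  adj′ : Fin (suc m) → Fin (suc m) → Bool
  adj′ zero    zero    = false
  adj′ zero    (suc j) = N j
  adj′ (suc i) zero    = N i
  adj′ (suc i) (suc j) = adj G i j
  sym′ : ∀ i j → adj′ i j ≡ adj′ j i
  sym′ zero    zero    = refl
  sym′ zero    (suc j) = refl
  sym′ (suc i) zero    = refl
  sym′ (suc i) (suc j) = Graph.sym G i j
  irrefl′ : ∀ i → adj′ i i ≡ false
  irrefl′ zero    = refl
  irrefl′ (suc i) = irrefl G i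

-- addVertex puts the new vertex at index 0, so prefix k consists of the k most
-- recently added vertices.
prefix : ∀ {m} → ℕ → Fin m → Bool
prefix k j = toℕ j <ᵇ k

count-prefix : ∀ k m → count {k + m} (prefix k) ≡ k
count-prefix zero    m = sum-replicate-zero m
count-prefix (suc k) m = cong suc (count-prefix k m)

module _ {m} {G : Graph m} {N : Fin m → Bool} where

  Reach-suc : ∀ {i j} → Reach G i j → Reach (addVertex G N) (suc i) (suc j)
  Reach-suc here        = here
  Reach-suc (step e ij) = step e (Reach-suc ij)

  InK4-suc : ∀ {i j} → InK4 G i j → InK4 (addVertex G N) (suc i) (suc j)
  InK4-suc (w , x , iw , ix , jw , jx , wx) = suc w , suc x , iw , ix , jw , jx , wx

Reach-trans : ∀ {m} {G : Graph m} {i j k} → Reach G i j → Reach G j k → Reach G i k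
Reach-trans here        jk = jk
Reach-trans (step e ij) jk = step e (Reach-trans ij jk)

addVertex-connected : ∀ {m} {G : Graph m} {N} p → N p ≡ true → Connected G → Connected (addVertex G N)
addVertex-connected p Np conn zero    zero    = here
addVertex-connected p Np conn zero    (suc j) = step Np (Reach-suc (conn _ j))
addVertex-connected p Np conn (suc i) zero    = Reach-trans (Reach-suc (conn i _)) (step Np here)
addVertex-connected p Np conn (suc i) (suc j) = Reach-suc (conn i j)

edgeCount-addVertex : ∀ {m} (G : Graph m) N → edgeCount (addVertex G N) ≡ count N + edgeCount G
edgeCount-addVertex G N =
  -- edgeSum (addVertex G N) unfolds to count N + edgeSum G.
  trans (edgeCount≡edgeSum (addVertex G N)) (cong (count N +_) (sym (edgeCount≡edgeSum G)))

edgeCount-addVertex-prefix : ∀ k {m} (G : Graph (k + m)) →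
                             edgeCount (addVertex G (prefix k)) ≡ k + edgeCount G
edgeCount-addVertex-prefix k {m} G =
  trans (edgeCount-addVertex G (prefix k)) (cong (_+ edgeCount G) (count-prefix k m))

K₁ : Graph 1
K₁ = record { adj = λ _ _ → false ; sym = λ _ _ → refl ; irrefl = λ _ → refl }

glueAtVertex : ∀ {m} → Graph (suc m) → Graph (4 + m)
glueAtVertex G = addVertex (addVertex (addVertex G (prefix 1)) (prefix 2)) (prefix 3)

glueAtEdge : ∀ {m} → Graph (2 + m) → Graph (4 + m)
glueAtEdge G = addVertex (addVertex G (prefix 2)) (prefix 3)

glueAtTriangle : ∀ {m} → Graph (3 + m) → Graph (4 + m)
glueAtTriangle G = addVertex G (prefix 3)

pattern 2+ i = suc (suc i)
pattern 3+ i = suc (suc (suc i))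
pattern 4+ i = suc (suc (suc (suc i)))
pattern K4⟨_,_⟩ w x = w , x , refl , refl , refl , refl , refl

module _ {m} (G : Graph (suc m)) where

  glueAtVertex-connected : Connected G → Connected (glueAtVertex G)
  glueAtVertex-connected =
    addVertex-connected 0F refl ∘ addVertex-connected 0F refl ∘ addVertex-connected 0F refl

  glueAtVertex-edgeCount : edgeCount (glueAtVertex G) ≡ 6 + edgeCount G
  glueAtVertex-edgeCount =
    trans (edgeCount-addVertex-prefix 3 (addVertex (addVertex G (prefix 1)) (prefix 2)))
          (cong (3 +_) (trans (edgeCount-addVertex-prefix 2 (addVertex G (prefix 1)))
                              (cong (2 +_) (edgeCount-addVertex-prefix 1 G))))

  glueAtVertex-cover : Has41Cover G → Has41Cover (glueAtVertex G)
  glueAtVertex-cover cov (3+ i) (3+ j) e = InK4-suc (InK4-suc (InK4-suc (cov i j e)))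
  glueAtVertex-cover cov 0F 1F _ = K4⟨ 2F , 3F ⟩
  glueAtVertex-cover cov 0F 2F _ = K4⟨ 1F , 3F ⟩
  glueAtVertex-cover cov 0F 3F _ = K4⟨ 1F , 2F ⟩
  glueAtVertex-cover cov 1F 0F _ = K4⟨ 2F , 3F ⟩
  glueAtVertex-cover cov 1F 2F _ = K4⟨ 0F , 3F ⟩
  glueAtVertex-cover cov 1F 3F _ = K4⟨ 0F , 2F ⟩
  glueAtVertex-cover cov 2F 0F _ = K4⟨ 1F , 3F ⟩
  glueAtVertex-cover cov 2F 1F _ = K4⟨ 0F , 3F ⟩
  glueAtVertex-cover cov 2F 3F _ = K4⟨ 0F , 1F ⟩
  glueAtVertex-cover cov 3F 0F _ = K4⟨ 1F , 2F ⟩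
  glueAtVertex-cover cov 3F 1F _ = K4⟨ 0F , 2F ⟩
  glueAtVertex-cover cov 3F 2F _ = K4⟨ 0F , 1F ⟩
  glueAtVertex-cover cov 0F 0F ()
  glueAtVertex-cover cov 1F 1F ()
  glueAtVertex-cover cov 2F 2F ()
  glueAtVertex-cover cov 0F (4+ _) ()
  glueAtVertex-cover cov 1F (4+ _) ()
  glueAtVertex-cover cov 2F (4+ _) ()
  glueAtVertex-cover cov (4+ _) 0F ()
  glueAtVertex-cover cov (4+ _) 1F ()
  glueAtVertex-cover cov (4+ _) 2F ()

module _ {m} (G : Graph (2 + m)) where

  glueAtEdge-connected : Connected G → Connected (glueAtEdge G)
  glueAtEdge-connected = addVertex-connected 0F refl ∘ addVertex-connected 0F refl

  glueAtEdge-edgeCount : edgeCount (glueAtEdge G) ≡ 5 + edgeCount G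
  glueAtEdge-edgeCount =
    trans (edgeCount-addVertex-prefix 3 (addVertex G (prefix 2))) (cong (3 +_) (edgeCount-addVertex-prefix 2 G))

  glueAtEdge-cover : Has41Cover G → adj G 0F 1F ≡ true → Has41Cover (glueAtEdge G)
  glueAtEdge-cover cov e (2+ i) (2+ j) e′ = InK4-suc (InK4-suc (cov i j e′))
  glueAtEdge-cover cov e 0F 1F _ = 2F , 3F , refl , refl , refl , refl , e
  glueAtEdge-cover cov e 0F 2F _ = 1F , 3F , refl , refl , refl , e , refl
  glueAtEdge-cover cov e 0F 3F _ = 1F , 2F , refl , refl , refl , adj-sym G e , refl
  glueAtEdge-cover cov e 1F 0F _ = 2F , 3F , refl , refl , refl , refl , e
  glueAtEdge-cover cov e 1F 2F _ = 0F , 3F , refl , refl , refl , e , refl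
  glueAtEdge-cover cov e 1F 3F _ = 0F , 2F , refl , refl , refl , adj-sym G e , refl
  glueAtEdge-cover cov e 2F 0F _ = 1F , 3F , refl , e , refl , refl , refl
  glueAtEdge-cover cov e 2F 1F _ = 0F , 3F , refl , e , refl , refl , refl
  glueAtEdge-cover cov e 3F 0F _ = 1F , 2F , refl , adj-sym G e , refl , refl , refl
  glueAtEdge-cover cov e 3F 1F _ = 0F , 2F , refl , adj-sym G e , refl , refl , refl
  glueAtEdge-cover cov e 0F 0F ()
  glueAtEdge-cover cov e 1F 1F ()
  glueAtEdge-cover cov e 0F (4+ _) ()
  glueAtEdge-cover cov e 1F (4+ _) ()
  glueAtEdge-cover cov e (4+ _) 0F ()
  glueAtEdge-cover cov e (4+ _) 1F ()

module _ {m} (G : Graph (3 + m)) where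

  glueAtTriangle-connected : Connected G → Connected (glueAtTriangle G)
  glueAtTriangle-connected = addVertex-connected 0F refl

  glueAtTriangle-edgeCount : edgeCount (glueAtTriangle G) ≡ 3 + edgeCount G
  glueAtTriangle-edgeCount = edgeCount-addVertex-prefix 3 G

  glueAtTriangle-cover : Has41Cover G → adj G 0F 1F ≡ true → adj G 0F 2F ≡ true → adj G 1F 2F ≡ true →
                         Has41Cover (glueAtTriangle G)
  glueAtTriangle-cover cov e₀₁ e₀₂ e₁₂ (suc i) (suc j) e = InK4-suc (cov i j e)
  glueAtTriangle-cover cov e₀₁ e₀₂ e₁₂ 0F 1F _ = 2F , 3F , refl , refl , e₀₁ , e₀₂ , e₁₂
  glueAtTriangle-cover cov e₀₁ e₀₂ e₁₂ 0F 2F _ = 1F , 3F , refl , refl , adj-sym G e₀₁ , e₁₂ , e₀₂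
  glueAtTriangle-cover cov e₀₁ e₀₂ e₁₂ 0F 3F _ = 1F , 2F , refl , refl , adj-sym G e₀₂ , adj-sym G e₁₂ , e₀₁
  glueAtTriangle-cover cov e₀₁ e₀₂ e₁₂ 1F 0F _ = 2F , 3F , e₀₁ , e₀₂ , refl , refl , e₁₂
  glueAtTriangle-cover cov e₀₁ e₀₂ e₁₂ 2F 0F _ = 1F , 3F , adj-sym G e₀₁ , e₁₂ , refl , refl , e₀₂
  glueAtTriangle-cover cov e₀₁ e₀₂ e₁₂ 3F 0F _ = 1F , 2F , adj-sym G e₀₂ , adj-sym G e₁₂ , refl , refl , e₀₁
  glueAtTriangle-cover cov e₀₁ e₀₂ e₁₂ 0F 0F ()
  glueAtTriangle-cover cov e₀₁ e₀₂ e₁₂ 0F (4+ _) ()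
  glueAtTriangle-cover cov e₀₁ e₀₂ e₁₂ (4+ _) 0F ()

K4chain : ∀ q → Graph (suc (q * 3))
K4chain zero    = K₁
K4chain (suc q) = glueAtVertex (K4chain q)

K4chain-connected : ∀ q → Connected (K4chain q)
K4chain-connected zero    0F 0F = here
K4chain-connected (suc q) = glueAtVertex-connected (K4chain q) (K4chain-connected q)

K4chain-cover : ∀ q → Has41Cover (K4chain q)
K4chain-cover zero    _ _ ()
K4chain-cover (suc q) = glueAtVertex-cover (K4chain q) (K4chain-cover q)

K4chain-edgeCount : ∀ q → edgeCount (K4chain q) ≡ q * 6
K4chain-edgeCount zero    = refl
K4chain-edgeCount (suc q) = trans (glueAtVertex-edgeCount (K4chain q)) (cong (6 +_) (K4chain-edgeCount q))

IsF-unique : ∀ {n a b} → IsF n a → IsF n b → a ≡ b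
IsF-unique ((G , conn , cov , refl) , a-min) ((H , conn′ , cov′ , refl) , b-min) =
  ≤-antisym (a-min H conn′ cov′) (b-min G conn cov)

≤-from-double : ∀ n {c s e} → 2 * n ≡ c + s → 2 * n ≤ e + s → c ≤ e
≤-from-double n {c} {s} {e} eq le = +-cancelʳ-≤ s c e (subst (_≤ e + s) eq le)

residue≢1 : ∀ r q → r % 3 ≢ 1 → (r + q * 3) % 3 ≢ 1
residue≢1 r q r≢1 eq = r≢1 (trans (sym ([m+kn]%n≡m%n r q 3)) eq)

isF-1mod3 : ∀ q → IsF (4 + q * 3) (6 + q * 6)
isF-1mod3 q =
  (K4chain (suc q) , K4chain-connected (suc q) , K4chain-cover (suc q) , K4chain-edgeCount (suc q)) ,
  λ G conn cov → ≤-from-double (4 + q * 3) (double q) (edgeCount-lowerBound G conn cov)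
  where
  double : ∀ q → 2 * (4 + q * 3) ≡ 6 + q * 6 + 2
  double = solve-∀

isF-2mod3 : ∀ q → IsF (5 + q * 3) (9 + q * 6)
isF-2mod3 q =
  (glueAtTriangle H , glueAtTriangle-connected H (K4chain-connected (suc q)) ,
   glueAtTriangle-cover H (K4chain-cover (suc q)) refl refl refl ,
   trans (glueAtTriangle-edgeCount H) (cong (3 +_) (K4chain-edgeCount (suc q)))) ,
  λ G conn cov → ≤-from-double (5 + q * 3) (double q) (edgeCount-lowerBound-≢1 G conn cov (residue≢1 5 q λ ()))
  where
  H = K4chain (suc q)
  double : ∀ q → 2 * (5 + q * 3) ≡ 9 + q * 6 + 1
  double = solve-∀

isF-0mod3 : ∀ q → IsF (6 + q * 3) (11 + q * 6)
isF-0mod3 q =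
  (glueAtEdge H , glueAtEdge-connected H (K4chain-connected (suc q)) ,
   glueAtEdge-cover H (K4chain-cover (suc q)) refl ,
   trans (glueAtEdge-edgeCount H) (cong (5 +_) (K4chain-edgeCount (suc q)))) ,
  λ G conn cov → ≤-from-double (6 + q * 3) (double q) (edgeCount-lowerBound-≢1 G conn cov (residue≢1 6 q λ ()))
  where
  H = K4chain (suc q)
  double : ∀ q → 2 * (6 + q * 3) ≡ 11 + q * 6 + 1
  double = solve-∀

F-increment : ∀ q r {a b} → 1 ≤ r → r ≤ 3 →
              IsF (r + (4 + q * 3)) a → IsF (r + (4 + q * 3) ∸ 1) b → a ≡ (4 ∸ r) + b
F-increment q 1 _ _ Fa Fb = trans (IsF-unique Fa (isF-2mod3 q)) (cong (3 +_) (IsF-unique (isF-1mod3 q) Fb))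
F-increment q 2 _ _ Fa Fb = trans (IsF-unique Fa (isF-0mod3 q)) (cong (2 +_) (IsF-unique (isF-2mod3 q) Fb))
F-increment q 3 _ _ Fa Fb = trans (IsF-unique Fa (isF-1mod3 (suc q))) (cong (1 +_) (IsF-unique (isF-0mod3 q) Fb))
F-increment q (4+ _) _ (s≤s (s≤s (s≤s ())))

increment-bound : ∀ {a b} r → 1 ≤ r → r ≤ 3 → a ≡ (4 ∸ r) + b → (a ≤ b + 3) × (a ≡ b + 3 ⇔ r ≡ 1)
increment-bound {b = b} 1 _ _ refl = ≤-reflexive (+-comm 3 b) , mk⇔ (λ _ → refl) (λ _ → +-comm 3 b)
increment-bound {b = b} 2 _ _ refl =
  ≤-trans (n≤1+n (2 + b)) (≤-reflexive (+-comm 3 b)) ,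
  mk⇔ (λ eq → contradiction (+-cancelʳ-≡ b 2 3 (trans eq (+-comm b 3))) λ ()) λ ()
increment-bound {b = b} 3 _ _ refl =
  ≤-trans (m≤n+m (1 + b) 2) (≤-reflexive (+-comm 3 b)) ,
  mk⇔ (λ eq → contradiction (+-cancelʳ-≡ b 1 3 (trans eq (+-comm b 3))) λ ()) λ ()
increment-bound (4+ _) _ (s≤s (s≤s (s≤s ()))) _

lemma3p3 : ∀ (n q r : ℕ) → n ≡ 4 + 3 * q + r → 1 ≤ r → r ≤ 3 →
    ∀ (a b : ℕ) → IsF n a → IsF (n ∸ 1) b →
    (a ≤ b + 3) × (a ≡ b + 3 ⇔ r ≡ 1)
lemma3p3 n q r n≡ 1≤r r≤3 a b Fa Fb =
  increment-bound r 1≤r r≤3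
    (F-increment q r 1≤r r≤3 (subst (λ n → IsF n a) shape Fa) (subst (λ n → IsF (n ∸ 1) b) shape Fb))
  where
  reshape : ∀ q r → 4 + 3 * q + r ≡ r + (4 + q * 3)
  reshape = solve-∀
  shape : n ≡ r + (4 + q * 3)
  shape = trans n≡ (reshape q r)
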